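{- Let $t$ be an edge labeling of $K_n$ with vertex set $V$, let $p$ be a positive integer, and let $m$ be a real number. If $$\sum_{u\in V}\big(|U_+(t,u)|+|U_-(t,u)|\big)\le nm,$$ then there exist two distinct vertices $u,v\in V$ with $$|U_+(t,u)|+|U_-(t,v)|+2|B(\{u,v\})|\le m+16.$$
   Context: $K_n$ is the complete graph on $n$ vertices with edge set $E$, $\epsilon=\binom n2$, $[a]=\{1,\dots,a\}$. For a vertex $v$, $D(v)$ is the set of edges containing $v$. An edge labeling is a bijection $t:E\to[\epsilon]$. With respect to the fixed $p$: $U_+(t,v)=\{e\in D(v):\exists e'\in D(v),\ t(e')=t(e)+p\}$, $U_-(t,v)=\{e\in D(v):\exists e'\in D(v),\ t(e')=t(e)-p\}$, and for distinct vertices $u,v$, $B(\{u,v\})$ is the set of unordered pairs $\{e_1,e_2\}$ of edges with $u\in e_1$, $v\in e_2$ and $|t(e_1)-t(e_2)|\in\{p,2p\}$.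
   Formalization: The number m, bounding the hypothesis and the conclusion, ranges over the rationals rather than over the real numbers. -}

module Defs where

open import Data.Nat as ℕ using (ℕ; suc; _+_; _≟_; ∣_-_∣)
open import Data.Nat.Combinatorics using (_C_)
open import Data.Fin as Fin using (Fin; toℕ)
open import Data.Fin.Properties as FinP using ()
open import Data.Product using (Σ; _×_; _,_; proj₁; proj₂)
open import Data.Sum using (_⊎_)
open import Data.Nat.ListAction using (sum)
open import Data.List using (List; filter; length; map; cartesianProduct; mapMaybe; allFin)
open import Data.List.Relation.Unary.Any using (Any; any?)
open import Data.Maybe using (Maybe; just; nothing)
open import Data.Integer as ℤ using ()
open import Data.Rational using (ℚ; _/_)
open import Function.Bundles using (Bijection)
open import Relation.Nullary using (yes; no)
open import Relation.Nullary.Decidable using (_×-dec_; _⊎-dec_)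
open import Relation.Binary.PropositionalEquality using (_≡_; setoid)

Edge : ℕ → Set
Edge n = Σ (Fin n × Fin n) (λ ij → proj₁ ij Fin.< proj₂ ij)

ε : ℕ → ℕ
ε n = n C 2

-- An edge labeling: a bijection E → [ε]; [ε] = {1,…,ε} is represented by Fin (ε n),
-- with Fin index k standing for label k+1 (see `lab`).
Labeling : ℕ → Set
Labeling n = Bijection (setoid (Edge n)) (setoid (Fin (ε n)))

lab : ∀ {n} → Labeling n → Edge n → ℕ
lab t e = suc (toℕ (Bijection.to t e))

edges : (n : ℕ) → List (Edge n)
edges n = mapMaybe pick (cartesianProduct (allFin n) (allFin n))
  where
  pick : Fin n × Fin n → Maybe (Edge n)
  pick (i , j) with i Fin.<? j
  ... | yes i<j = just ((i , j) , i<j)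
  ... | no  _   = nothing

_∈ᵉ_ : ∀ {n} → Fin n → Edge n → Set
v ∈ᵉ ((i , j) , _) = (v ≡ i) ⊎ (v ≡ j)

infix 4 _∈ᵉ_

_∈ᵉ?_ : ∀ {n} (v : Fin n) (e : Edge n) → Relation.Nullary.Dec (v ∈ᵉ e)
v ∈ᵉ? ((i , j) , _) = (v Fin.≟ i) ⊎-dec (v Fin.≟ j)

D : ∀ {n} → Fin n → List (Edge n)
D {n} v = filter (v ∈ᵉ?_) (edges n)

U₊ : ∀ {n} → ℕ → Labeling n → Fin n → List (Edge n)
U₊ p t v = filter (λ e → any? (λ e' → lab t e' ≟ lab t e + p) (D v)) (D v)

U₋ : ∀ {n} → ℕ → Labeling n → Fin n → List (Edge n)
U₋ p t v = filter (λ e → any? (λ e' → lab t e' + p ≟ lab t e) (D v)) (D v)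

-- Each unordered pair {a,b} of edges with
-- distinct labels is represented exactly once, as the ordered pair (a,b) with t(a) < t(b).
-- (Pairs with equal labels have difference 0 ∉ {p,2p} for p > 0; as t is injective they are a = b.)
B : ∀ {n} → ℕ → Labeling n → Fin n → Fin n → List (Edge n × Edge n)
B {n} p t u v = filter cond (cartesianProduct (edges n) (edges n))
  where
  cond : (ab : Edge n × Edge n) → Relation.Nullary.Dec _
  cond (a , b) =
    (lab t a ℕ.<? lab t b)
    ×-dec (((u ∈ᵉ? a) ×-dec (v ∈ᵉ? b)) ⊎-dec ((u ∈ᵉ? b) ×-dec (v ∈ᵉ? a)))
    ×-dec ((∣ lab t a - lab t b ∣ ≟ p) ⊎-dec (∣ lab t a - lab t b ∣ ≟ 2 ℕ.* p))

degreeSum : ∀ {n} → ℕ → Labeling n → ℕ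
degreeSum {n} p t = sum (map (λ u → length (U₊ p t u) + length (U₋ p t u)) (allFin n))

ℕ→ℚ : ℕ → ℚ
ℕ→ℚ k = (ℤ.+ k) / 1

{-# OPTIONS --safe #-}
-- Average |U₊(u)| + |U₋(v)| + 2|B{u,v}| over the n(n−1) ordered pairs of distinct vertices.
-- The U-terms sum to (n−1) Σ_u (|U₊(u)| + |U₋(u)|) ≤ (n−1) n m.  A pair of edges whose labels
-- differ by p or 2p lies in B{u,v} only if u and v are endpoints of the two edges, which happens
-- for at most 8 ordered pairs (u,v); and as labels are distinct, every edge is the lower edge of
-- at most two such pairs.  So Σ_{u,v} |B{u,v}| ≤ 16 |E| = 8 n (n−1), the average is at most
-- m + 16, and some pair is at most the average.
module Submission where

open import Defs
open import Data.Nat using (ℕ; _+_; _*_; _≤_; _>_)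
open import Data.Fin using (Fin)
open import Data.Rational using (ℚ) renaming (_≤_ to _≤ℚ_; _+_ to _+ℚ_; _*_ to _*ℚ_)
open import Data.List using (length)
open import Data.Product using (Σ-syntax; _×_)
open import Relation.Nullary using (¬_)
open import Relation.Binary.PropositionalEquality using (_≡_)

open import Algebra.Properties.CommutativeSemigroup using (interchange)
open import Data.Bool using (Bool; true; false; not; _∧_; _∨_)
import Data.Fin as Fin
import Data.Fin.Properties as Finₚ
import Data.Integer as ℤ
import Data.Integer.Properties as ℤ
open import Data.List using (List; []; _∷_; _++_; map; filter; mapMaybe; cartesianProduct; allFin)
open import Data.List.Membership.Propositional using (_∈_; find)
open import Data.List.Membership.Propositional.Properties using (∈-allFin; ∈-filter⁻)
open import Data.List.Properties using (map-cong; map-∘; map-++; length-map; length-tabulate)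
open import Data.List.Relation.Unary.All as All using (All; []; _∷_)
open import Data.List.Relation.Unary.All.Properties using (¬Any⇒All¬)
open import Data.List.Relation.Unary.AllPairs using ([]; _∷_)
open import Data.List.Relation.Unary.Any using (Any; here; there; any?)
open import Data.List.Relation.Unary.Unique.Propositional using (Unique)
import Data.List.Relation.Unary.Unique.Propositional.Properties as Unique
open import Data.Maybe using (Maybe)
open import Data.Nat as ℕ using (suc; _∸_; _<_; z≤n; s≤s; ∣_-_∣)
import Data.Nat.Coprimality as Coprime
open import Data.Nat.ListAction using (sum)
open import Data.Nat.ListAction.Properties using (sum-++)
open import Data.Nat.Properties
open import Data.Product using (_,_; proj₁; proj₂)
import Data.Rational as ℚ
import Data.Rational.Properties as ℚ
open import Data.Rational.Solver using (module +-*-Solver)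
open import Function using (_∘_)
open import Function.Bundles using (Bijection)
open import Level using (0ℓ)
open import Relation.Binary.Definitions using (DecidableEquality)
open import Relation.Binary.PropositionalEquality
  using (_≢_; refl; sym; trans; cong; cong₂; subst; subst₂; module ≡-Reasoning)
open import Relation.Nullary using (Dec; yes; no; does; contradiction; ¬?)
open import Relation.Nullary.Decidable using (dec-true; dec-false)
open import Relation.Unary using (Pred; Decidable)

private variable
  X Y : Set

𝟙 : Bool → ℕ
𝟙 true  = 1
𝟙 false = 0

𝟙≤1 : ∀ x → 𝟙 x ≤ 1
𝟙≤1 true  = ≤-refl
𝟙≤1 false = z≤n

𝟙-∧ : ∀ x y → 𝟙 (x ∧ y) ≡ 𝟙 x * 𝟙 y
𝟙-∧ true  y = sym (+-identityʳ (𝟙 y))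
𝟙-∧ false y = refl

𝟙-∨ : ∀ x y → 𝟙 (x ∨ y) ≤ 𝟙 x + 𝟙 y
𝟙-∨ true  y = s≤s z≤n
𝟙-∨ false y = ≤-refl

𝟙-not : ∀ x → 𝟙 (not x) + 𝟙 x ≡ 1
𝟙-not true  = refl
𝟙-not false = refl

∑ : (X → ℕ) → List X → ℕ
∑ f xs = sum (map f xs)

syntax ∑ (λ x → e) xs = ∑[ x ∈ xs ] e

∑-cong : {f g : X → ℕ} → (∀ x → f x ≡ g x) → ∀ xs → ∑ f xs ≡ ∑ g xs
∑-cong f≗g xs = cong sum (map-cong f≗g xs)

∑-mono-≤ : {f g : X → ℕ} → (∀ x → f x ≤ g x) → ∀ xs → ∑ f xs ≤ ∑ g xs
∑-mono-≤ f≤g []       = z≤n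
∑-mono-≤ f≤g (x ∷ xs) = +-mono-≤ (f≤g x) (∑-mono-≤ f≤g xs)

∑-++ : (f : X → ℕ) → ∀ xs ys → ∑ f (xs ++ ys) ≡ ∑ f xs + ∑ f ys
∑-++ f xs ys = trans (cong sum (map-++ f xs ys)) (sum-++ (map f xs) (map f ys))

∑-map : (f : Y → ℕ) (g : X → Y) → ∀ xs → ∑ f (map g xs) ≡ ∑ (f ∘ g) xs
∑-map f g xs = cong sum (sym (map-∘ xs))

∑-const : (c : ℕ) (xs : List X) → ∑[ _ ∈ xs ] c ≡ length xs * c
∑-const c []       = refl
∑-const c (x ∷ xs) = cong (c +_) (∑-const c xs)

length≡∑1 : (xs : List X) → length xs ≡ ∑[ _ ∈ xs ] 1
length≡∑1 xs = sym (trans (∑-const 1 xs) (*-identityʳ (length xs)))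

length-allFin : ∀ n → length (allFin n) ≡ n
length-allFin n = length-tabulate {A = Fin n} (λ i → i)

∑-distrib-+ : (f g : X → ℕ) → ∀ xs → ∑[ x ∈ xs ] (f x + g x) ≡ ∑ f xs + ∑ g xs
∑-distrib-+ f g []       = refl
∑-distrib-+ f g (x ∷ xs) =
  trans (cong (f x + g x +_) (∑-distrib-+ f g xs)) (interchange +-commutativeSemigroup (f x) (g x) (∑ f xs) (∑ g xs))

∑-*ˡ : (c : ℕ) (f : X → ℕ) → ∀ xs → ∑[ x ∈ xs ] (c * f x) ≡ c * ∑ f xs
∑-*ˡ c f []       = sym (*-zeroʳ c)
∑-*ˡ c f (x ∷ xs) = trans (cong (c * f x +_) (∑-*ˡ c f xs)) (sym (*-distribˡ-+ c (f x) (∑ f xs)))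

∑-*ʳ : (c : ℕ) (f : X → ℕ) → ∀ xs → ∑[ x ∈ xs ] (f x * c) ≡ ∑ f xs * c
∑-*ʳ c f xs = trans (∑-cong (λ x → *-comm (f x) c) xs) (trans (∑-*ˡ c f xs) (*-comm c (∑ f xs)))

∑-comm : (f : X → Y → ℕ) → ∀ xs ys → ∑[ x ∈ xs ] ∑[ y ∈ ys ] f x y ≡ ∑[ y ∈ ys ] ∑[ x ∈ xs ] f x y
∑-comm f []       ys = sym (trans (∑-const 0 ys) (*-zeroʳ (length ys)))
∑-comm f (x ∷ xs) ys =
  trans (cong (∑ (f x) ys +_) (∑-comm f xs ys)) (sym (∑-distrib-+ (f x) (λ y → ∑[ x ∈ xs ] f x y) ys))

∑-product : (f : X → ℕ) (g : Y → ℕ) → ∀ xs ys → ∑[ x ∈ xs ] ∑[ y ∈ ys ] (f x * g y) ≡ ∑ f xs * ∑ g ys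
∑-product f g xs ys = trans (∑-cong (λ x → ∑-*ˡ (f x) g ys) xs) (∑-*ʳ (∑ g ys) f xs)

∑-cartesianProduct : (f : X × Y → ℕ) → ∀ xs ys →
                     ∑ f (cartesianProduct xs ys) ≡ ∑[ x ∈ xs ] ∑[ y ∈ ys ] f (x , y)
∑-cartesianProduct f []       ys = refl
∑-cartesianProduct f (x ∷ xs) ys =
  trans (∑-++ f (map (x ,_) ys) (cartesianProduct xs ys))
        (cong₂ _+_ (∑-map f (x ,_) ys) (∑-cartesianProduct f xs ys))

module _ {P : Pred X 0ℓ} (P? : Decidable P) where

  ∑-filter : (f : X → ℕ) → ∀ xs → ∑ f (filter P? xs) ≡ ∑[ x ∈ xs ] (𝟙 (does (P? x)) * f x)
  ∑-filter f []       = refl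
  ∑-filter f (x ∷ xs) with does (P? x)
  ... | true  = cong₂ _+_ (sym (+-identityʳ (f x))) (∑-filter f xs)
  ... | false = ∑-filter f xs

  ∑-filter-≤ : (f : X → ℕ) → ∀ xs → ∑ f (filter P? xs) ≤ ∑ f xs
  ∑-filter-≤ f xs = subst (_≤ ∑ f xs) (sym (∑-filter f xs)) (∑-mono-≤ 𝟙*f≤f xs)
    where
    𝟙*f≤f : ∀ x → 𝟙 (does (P? x)) * f x ≤ f x
    𝟙*f≤f x = subst (𝟙 (does (P? x)) * f x ≤_) (*-identityˡ (f x)) (*-monoˡ-≤ (f x) (𝟙≤1 (does (P? x))))

  length-filter : ∀ xs → length (filter P? xs) ≡ ∑[ x ∈ xs ] 𝟙 (does (P? x))
  length-filter xs = begin
    length (filter P? xs)                  ≡⟨ length≡∑1 (filter P? xs) ⟩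
    ∑[ _ ∈ filter P? xs ] 1                ≡⟨ ∑-filter (λ _ → 1) xs ⟩
    ∑[ x ∈ xs ] (𝟙 (does (P? x)) * 1)      ≡⟨ ∑-cong (λ x → *-identityʳ (𝟙 (does (P? x)))) xs ⟩
    ∑[ x ∈ xs ] 𝟙 (does (P? x))            ∎
    where open ≡-Reasoning

module _ (_≟_ : DecidableEquality X) where

  count-absent : ∀ {k xs} → All (k ≢_) xs → ∑[ x ∈ xs ] 𝟙 (does (x ≟ k)) ≡ 0
  count-absent {k} []                  = refl
  count-absent {k} {x ∷ _} (k≢x ∷ k∉xs) with x ≟ k
  ... | yes refl = contradiction refl k≢x
  ... | no _     = count-absent k∉xs

  count-unique≤1 : ∀ {xs} k → Unique xs → ∑[ x ∈ xs ] 𝟙 (does (x ≟ k)) ≤ 1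
  count-unique≤1 k [] = z≤n
  count-unique≤1 {x ∷ _} k (x∉xs ∷ xs!) with x ≟ k
  ... | yes refl = ≤-reflexive (cong suc (count-absent x∉xs))
  ... | no _     = count-unique≤1 k xs!

  count-∈≥1 : ∀ {k xs} → k ∈ xs → 1 ≤ ∑[ x ∈ xs ] 𝟙 (does (x ≟ k))
  count-∈≥1 {k} (here refl) with k ≟ k
  ... | yes _   = s≤s z≤n
  ... | no k≢k = contradiction refl k≢k
  count-∈≥1 {k} {x ∷ _} (there k∈xs) = ≤-trans (count-∈≥1 k∈xs) (m≤n+m _ (𝟙 (does (x ≟ k))))

count-allFin : ∀ {n} (u : Fin n) → ∑[ v ∈ allFin n ] 𝟙 (does (v Fin.≟ u)) ≡ 1
count-allFin {n} u = ≤-antisym (count-unique≤1 Fin._≟_ u (Unique.allFin⁺ n)) (count-∈≥1 Fin._≟_ (∈-allFin u))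

does-≟-sym : ∀ {n} (u v : Fin n) → does (u Fin.≟ v) ≡ does (v Fin.≟ u)
does-≟-sym u v with u Fin.≟ v | v Fin.≟ u
... | yes _   | yes _   = refl
... | no _    | no _    = refl
... | yes u≡v | no v≢u = contradiction (sym u≡v) v≢u
... | no u≢v  | yes v≡u = contradiction (sym v≡u) u≢v

count-≢-allFin : ∀ {n} (v : Fin n) → ∑[ u ∈ allFin n ] 𝟙 (not (does (u Fin.≟ v))) ≡ n ∸ 1
count-≢-allFin {n} v = begin
  others                                    ≡⟨ m+n∸n≡m others 1 ⟨
  others + 1 ∸ 1                            ≡⟨ cong (λ c → others + c ∸ 1) (count-allFin v) ⟨
  others + ∑[ u ∈ V ] 𝟙 (does (u Fin.≟ v)) ∸ 1
    ≡⟨ cong (_∸ 1) (∑-distrib-+ (λ u → 𝟙 (not (does (u Fin.≟ v)))) (λ u → 𝟙 (does (u Fin.≟ v))) V) ⟨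
  ∑[ u ∈ V ] (𝟙 (not (does (u Fin.≟ v))) + 𝟙 (does (u Fin.≟ v))) ∸ 1
    ≡⟨ cong (_∸ 1) (∑-cong (λ u → 𝟙-not (does (u Fin.≟ v))) V) ⟩
  ∑[ _ ∈ V ] 1 ∸ 1                          ≡⟨ cong (_∸ 1) (trans (sym (length≡∑1 V)) (length-allFin n)) ⟩
  n ∸ 1                                     ∎
  where
  open ≡-Reasoning
  V = allFin n
  others = ∑[ u ∈ V ] 𝟙 (not (does (u Fin.≟ v)))

vertexPairs : (n : ℕ) → List (Fin n × Fin n)
vertexPairs n = cartesianProduct (allFin n) (allFin n)

distinctPairs : (n : ℕ) → List (Fin n × Fin n)
distinctPairs n = filter (λ uv → ¬? (proj₁ uv Fin.≟ proj₂ uv)) (vertexPairs n)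

∈-distinctPairs⇒≢ : ∀ {n} {uv : Fin n × Fin n} → uv ∈ distinctPairs n → proj₁ uv ≢ proj₂ uv
∈-distinctPairs⇒≢ {n} = proj₂ ∘ ∈-filter⁻ (λ uv → ¬? (proj₁ uv Fin.≟ proj₂ uv)) {xs = vertexPairs n}

module _ {n : ℕ} where

  private
    V : List (Fin n)
    V = allFin n

    u≢v : Fin n → Fin n → ℕ
    u≢v u v = 𝟙 (not (does (u Fin.≟ v)))

  ∑-distinctPairs : (h : Fin n × Fin n → ℕ) →
                    ∑ h (distinctPairs n) ≡ ∑[ u ∈ V ] ∑[ v ∈ V ] (u≢v u v * h (u , v))
  ∑-distinctPairs h =
    trans (∑-filter _ h (vertexPairs n)) (∑-cartesianProduct (λ uv → u≢v (proj₁ uv) (proj₂ uv) * h uv) V V)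

  ∑-distinctPairs-proj₁ : (f : Fin n → ℕ) → ∑[ uv ∈ distinctPairs n ] f (proj₁ uv) ≡ (n ∸ 1) * ∑ f V
  ∑-distinctPairs-proj₁ f = begin
    ∑[ uv ∈ distinctPairs n ] f (proj₁ uv)          ≡⟨ ∑-distinctPairs (f ∘ proj₁) ⟩
    ∑[ u ∈ V ] ∑[ v ∈ V ] (u≢v u v * f u)           ≡⟨ ∑-cong (λ u → ∑-*ʳ (f u) (u≢v u) V) V ⟩
    ∑[ u ∈ V ] (∑[ v ∈ V ] u≢v u v * f u)           ≡⟨ ∑-cong (λ u → cong (_* f u) (others u)) V ⟩
    ∑[ u ∈ V ] ((n ∸ 1) * f u)                      ≡⟨ ∑-*ˡ (n ∸ 1) f V ⟩
    (n ∸ 1) * ∑ f V                                 ∎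
    where
    open ≡-Reasoning
    others : ∀ u → ∑[ v ∈ V ] u≢v u v ≡ n ∸ 1
    others u = trans (∑-cong (λ v → cong (𝟙 ∘ not) (does-≟-sym u v)) V) (count-≢-allFin u)

  ∑-distinctPairs-proj₂ : (f : Fin n → ℕ) → ∑[ uv ∈ distinctPairs n ] f (proj₂ uv) ≡ (n ∸ 1) * ∑ f V
  ∑-distinctPairs-proj₂ f = begin
    ∑[ uv ∈ distinctPairs n ] f (proj₂ uv)          ≡⟨ ∑-distinctPairs (f ∘ proj₂) ⟩
    ∑[ u ∈ V ] ∑[ v ∈ V ] (u≢v u v * f v)           ≡⟨ ∑-comm (λ u v → u≢v u v * f v) V V ⟩
    ∑[ v ∈ V ] ∑[ u ∈ V ] (u≢v u v * f v)           ≡⟨ ∑-cong (λ v → ∑-*ʳ (f v) (λ u → u≢v u v) V) V ⟩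
    ∑[ v ∈ V ] (∑[ u ∈ V ] u≢v u v * f v)           ≡⟨ ∑-cong (λ v → cong (_* f v) (count-≢-allFin v)) V ⟩
    ∑[ v ∈ V ] ((n ∸ 1) * f v)                      ≡⟨ ∑-*ˡ (n ∸ 1) f V ⟩
    (n ∸ 1) * ∑ f V                                 ∎
    where open ≡-Reasoning

  length-distinctPairs : length (distinctPairs n) ≡ (n ∸ 1) * n
  length-distinctPairs = begin
    length (distinctPairs n)          ≡⟨ length≡∑1 (distinctPairs n) ⟩
    ∑[ _ ∈ distinctPairs n ] 1        ≡⟨ ∑-distinctPairs-proj₁ (λ _ → 1) ⟩
    (n ∸ 1) * ∑[ _ ∈ V ] 1            ≡⟨ cong ((n ∸ 1) *_) (trans (sym (length≡∑1 V)) (length-allFin n)) ⟩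
    (n ∸ 1) * n                       ∎
    where open ≡-Reasoning

-- `Defs.edges` selects pairs with a function local to its where-block; unification recovers it.
edges-as-mapMaybe : ∀ n → Σ[ pick ∈ (Fin n × Fin n → Maybe (Edge n)) ] edges n ≡ mapMaybe pick (vertexPairs n)
edges-as-mapMaybe n = _ , refl

map-proj₁-edges : ∀ n → map proj₁ (edges n) ≡ filter (λ ij → proj₁ ij Fin.<? proj₂ ij) (vertexPairs n)
map-proj₁-edges n = trans (cong (map proj₁) (proj₂ (edges-as-mapMaybe n))) (go (vertexPairs n))
  where
  go : ∀ ijs → map proj₁ (mapMaybe (proj₁ (edges-as-mapMaybe n)) ijs) ≡ filter (λ ij → proj₁ ij Fin.<? proj₂ ij) ijs
  go []              = refl
  go ((i , j) ∷ ijs) with i Fin.<? j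
  ... | yes i<j rewrite dec-true (i Fin.<? j) i<j = cong ((i , j) ∷_) (go ijs)
  ... | no i≮j rewrite dec-false (i Fin.<? j) i≮j = go ijs

edges-unique : ∀ n → Unique (edges n)
edges-unique n = Unique.map⁻ (subst Unique (sym (map-proj₁-edges n))
  (Unique.filter⁺ _ (Unique.cartesianProduct⁺ (Unique.allFin⁺ n) (Unique.allFin⁺ n))))

𝟙<+𝟙>≤𝟙≢ : ∀ {n} (u v : Fin n) → 𝟙 (does (u Fin.<? v)) + 𝟙 (does (v Fin.<? u)) ≤ 𝟙 (not (does (u Fin.≟ v)))
𝟙<+𝟙>≤𝟙≢ u v = go (u Fin.<? v) (v Fin.<? u) (u Fin.≟ v)
  where
  go : (u<v? : Dec (u Fin.< v)) (v<u? : Dec (v Fin.< u)) (u≟v : Dec (u ≡ v)) →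
       𝟙 (does u<v?) + 𝟙 (does v<u?) ≤ 𝟙 (not (does u≟v))
  go (yes u<v) (yes v<u) _          = contradiction v<u (Finₚ.<-asym u<v)
  go (yes u<v) _         (yes refl) = contradiction u<v (Finₚ.<-irrefl refl)
  go (yes _)   (no _)    (no _)     = ≤-refl
  go (no _)    (yes v<u) (yes refl) = contradiction v<u (Finₚ.<-irrefl refl)
  go (no _)    (yes _)   (no _)     = ≤-refl
  go (no _)    (no _)    _          = z≤n

length-edges : ∀ n → length (edges n) ≡ ∑[ u ∈ allFin n ] ∑[ v ∈ allFin n ] 𝟙 (does (u Fin.<? v))
length-edges n = begin
  length (edges n)                   ≡⟨ length-map proj₁ (edges n) ⟨
  length (map proj₁ (edges n))       ≡⟨ cong length (map-proj₁-edges n) ⟩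
  length (filter _ (vertexPairs n))  ≡⟨ length-filter _ (vertexPairs n) ⟩
  ∑[ uv ∈ vertexPairs n ] 𝟙 (does (proj₁ uv Fin.<? proj₂ uv))
    ≡⟨ ∑-cartesianProduct (λ uv → 𝟙 (does (proj₁ uv Fin.<? proj₂ uv))) (allFin n) (allFin n) ⟩
  ∑[ u ∈ allFin n ] ∑[ v ∈ allFin n ] 𝟙 (does (u Fin.<? v)) ∎
  where open ≡-Reasoning

2*length-edges≤length-distinctPairs : ∀ n → 2 * length (edges n) ≤ length (distinctPairs n)
2*length-edges≤length-distinctPairs n = begin
  2 * length (edges n)                                    ≡⟨ cong (2 *_) (length-edges n) ⟩
  2 * L                                                   ≡⟨ cong (L +_) (+-identityʳ L) ⟩
  L + L                                                   ≡⟨ cong (L +_) (∑-comm (λ u v → 𝟙 (does (u Fin.<? v))) V V) ⟩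
  L + ∑[ u ∈ V ] ∑[ v ∈ V ] 𝟙 (does (v Fin.<? u))
    ≡⟨ ∑-distrib-+ (λ u → ∑[ v ∈ V ] 𝟙 (does (u Fin.<? v))) (λ u → ∑[ v ∈ V ] 𝟙 (does (v Fin.<? u))) V ⟨
  ∑[ u ∈ V ] (∑[ v ∈ V ] 𝟙 (does (u Fin.<? v)) + ∑[ v ∈ V ] 𝟙 (does (v Fin.<? u)))
    ≡⟨ ∑-cong (λ u → ∑-distrib-+ (λ v → 𝟙 (does (u Fin.<? v))) (λ v → 𝟙 (does (v Fin.<? u))) V) V ⟨
  ∑[ u ∈ V ] ∑[ v ∈ V ] (𝟙 (does (u Fin.<? v)) + 𝟙 (does (v Fin.<? u)))
    ≤⟨ ∑-mono-≤ (λ u → ∑-mono-≤ (𝟙<+𝟙>≤𝟙≢ u) V) V ⟩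
  ∑[ u ∈ V ] ∑[ v ∈ V ] 𝟙 (not (does (u Fin.≟ v)))
    ≡⟨ ∑-cartesianProduct (λ uv → 𝟙 (not (does (proj₁ uv Fin.≟ proj₂ uv)))) V V ⟨
  ∑[ uv ∈ vertexPairs n ] 𝟙 (not (does (proj₁ uv Fin.≟ proj₂ uv)))
    ≡⟨ length-filter _ (vertexPairs n) ⟨
  length (distinctPairs n)                                ∎
  where
  open ≤-Reasoning
  V = allFin n
  L = ∑[ u ∈ V ] ∑[ v ∈ V ] 𝟙 (does (u Fin.<? v))

lab-injective : ∀ {n} (t : Labeling n) {e e′ : Edge n} → lab t e ≡ lab t e′ → e ≡ e′
lab-injective t eq = Bijection.injective t (Finₚ.toℕ-injective (suc-injective eq))

count-label≤1 : ∀ {n} (t : Labeling n) (k : ℕ) → ∑[ e ∈ edges n ] 𝟙 (does (lab t e ℕ.≟ k)) ≤ 1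
count-label≤1 {n} t k = subst (_≤ 1) (∑-map (λ ℓ → 𝟙 (does (ℓ ℕ.≟ k))) (lab t) (edges n))
  (count-unique≤1 ℕ._≟_ k (Unique.map⁺ (lab-injective t) (edges-unique n)))

<⇒∣-∣≡⇒≡+ : ∀ {x y d} → x < y → ∣ x - y ∣ ≡ d → y ≡ x + d
<⇒∣-∣≡⇒≡+ {x} x<y refl =
  sym (trans (cong (x +_) (m≤n⇒∣m-n∣≡n∸m (<⇒≤ x<y))) (m+[n∸m]≡n (<⇒≤ x<y)))

𝟙-gap≤ : ∀ x y p → 𝟙 (does (x ℕ.<? y) ∧ (does (∣ x - y ∣ ℕ.≟ p) ∨ does (∣ x - y ∣ ℕ.≟ 2 * p)))
                    ≤ 𝟙 (does (y ℕ.≟ x + p)) + 𝟙 (does (y ℕ.≟ x + 2 * p))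
𝟙-gap≤ x y p = go (x ℕ.<? y) (∣ x - y ∣ ℕ.≟ p) (∣ x - y ∣ ℕ.≟ 2 * p)
  where
  go : (x<y? : Dec (x < y)) (≡p? : Dec (∣ x - y ∣ ≡ p)) (≡2p? : Dec (∣ x - y ∣ ≡ 2 * p)) →
       𝟙 (does x<y? ∧ (does ≡p? ∨ does ≡2p?)) ≤ 𝟙 (does (y ℕ.≟ x + p)) + 𝟙 (does (y ℕ.≟ x + 2 * p))
  go (no _)    _          _ = z≤n
  go (yes x<y) (yes ≡p)   _
    rewrite dec-true (y ℕ.≟ x + p) (<⇒∣-∣≡⇒≡+ x<y ≡p) = s≤s z≤n
  go (yes x<y) (no _) (yes ≡2p)
    rewrite dec-true (y ℕ.≟ x + 2 * p) (<⇒∣-∣≡⇒≡+ x<y ≡2p) = m≤n+m 1 (𝟙 (does (y ℕ.≟ x + p)))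
  go (yes _)   (no _)   (no _) = z≤n

𝟙-∧-∧ : ∀ x o y → 𝟙 (x ∧ (o ∧ y)) ≡ 𝟙 (x ∧ y) * 𝟙 o
𝟙-∧-∧ true  o y = trans (𝟙-∧ o y) (*-comm (𝟙 o) (𝟙 y))
𝟙-∧-∧ false o y = refl

endpoints≤2 : ∀ {n} (e : Edge n) → ∑[ u ∈ allFin n ] 𝟙 (does (u ∈ᵉ? e)) ≤ 2
endpoints≤2 {n} ((i , j) , _) = begin
  ∑[ u ∈ V ] 𝟙 (does (u Fin.≟ i) ∨ does (u Fin.≟ j))
    ≤⟨ ∑-mono-≤ (λ u → 𝟙-∨ (does (u Fin.≟ i)) (does (u Fin.≟ j))) V ⟩
  ∑[ u ∈ V ] (𝟙 (does (u Fin.≟ i)) + 𝟙 (does (u Fin.≟ j)))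
    ≡⟨ ∑-distrib-+ (λ u → 𝟙 (does (u Fin.≟ i))) (λ u → 𝟙 (does (u Fin.≟ j))) V ⟩
  ∑[ u ∈ V ] 𝟙 (does (u Fin.≟ i)) + ∑[ u ∈ V ] 𝟙 (does (u Fin.≟ j))
    ≡⟨ cong₂ _+_ (count-allFin i) (count-allFin j) ⟩
  2 ∎
  where
  open ≤-Reasoning
  V = allFin n

module _ {n : ℕ} (t : Labeling n) (p : ℕ) where

  private
    V : List (Fin n)
    V = allFin n

    E : List (Edge n)
    E = edges n

    E² : List (Edge n × Edge n)
    E² = cartesianProduct E E

  apart : Edge n × Edge n → Bool
  apart (a , b) = does (∣ lab t a - lab t b ∣ ℕ.≟ p) ∨ does (∣ lab t a - lab t b ∣ ℕ.≟ 2 * p)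

  near : Edge n × Edge n → Bool
  near (a , b) = does (lab t a ℕ.<? lab t b) ∧ apart (a , b)

  joins : Fin n → Fin n → Edge n × Edge n → Bool
  joins u v (a , b) = does (u ∈ᵉ? a) ∧ does (v ∈ᵉ? b) ∨ does (u ∈ᵉ? b) ∧ does (v ∈ᵉ? a)

  length-B : ∀ u v → length (B p t u v) ≡ ∑[ ab ∈ E² ] (𝟙 (near ab) * 𝟙 (joins u v ab))
  length-B u v = trans (length-filter _ E²)
    (∑-cong (λ ab → 𝟙-∧-∧ (does (lab t (proj₁ ab) ℕ.<? lab t (proj₂ ab))) (joins u v ab) (apart ab)) E²)

  near-count : ∑[ ab ∈ E² ] 𝟙 (near ab) ≤ length E * 2
  near-count = begin
    ∑[ ab ∈ E² ] 𝟙 (near ab)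
      ≡⟨ ∑-cartesianProduct (𝟙 ∘ near) E E ⟩
    ∑[ a ∈ E ] ∑[ b ∈ E ] 𝟙 (near (a , b))
      ≤⟨ ∑-mono-≤ (λ a → ∑-mono-≤ (λ b → 𝟙-gap≤ (lab t a) (lab t b) p) E) E ⟩
    ∑[ a ∈ E ] ∑[ b ∈ E ] (𝟙 (does (lab t b ℕ.≟ lab t a + p)) + 𝟙 (does (lab t b ℕ.≟ lab t a + 2 * p)))
      ≡⟨ ∑-cong (λ a → ∑-distrib-+ (λ b → 𝟙 (does (lab t b ℕ.≟ lab t a + p)))
                                   (λ b → 𝟙 (does (lab t b ℕ.≟ lab t a + 2 * p))) E) E ⟩
    ∑[ a ∈ E ] (∑[ b ∈ E ] 𝟙 (does (lab t b ℕ.≟ lab t a + p)) + ∑[ b ∈ E ] 𝟙 (does (lab t b ℕ.≟ lab t a + 2 * p)))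
      ≤⟨ ∑-mono-≤ (λ a → +-mono-≤ (count-label≤1 t (lab t a + p)) (count-label≤1 t (lab t a + 2 * p))) E ⟩
    ∑[ _ ∈ E ] 2
      ≡⟨ ∑-const 2 E ⟩
    length E * 2 ∎
    where open ≤-Reasoning

  joins-count : ∀ ab → ∑[ u ∈ V ] ∑[ v ∈ V ] 𝟙 (joins u v ab) ≤ 8
  joins-count (a , b) = begin
    ∑[ u ∈ V ] ∑[ v ∈ V ] 𝟙 (joins u v (a , b))
      ≤⟨ ∑-mono-≤ (λ u → ∑-mono-≤ (λ v → joins≤ u v) V) V ⟩
    ∑[ u ∈ V ] ∑[ v ∈ V ] (∈a u * ∈b v + ∈b u * ∈a v)
      ≡⟨ ∑-cong (λ u → ∑-distrib-+ (λ v → ∈a u * ∈b v) (λ v → ∈b u * ∈a v) V) V ⟩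
    ∑[ u ∈ V ] (∑[ v ∈ V ] (∈a u * ∈b v) + ∑[ v ∈ V ] (∈b u * ∈a v))
      ≡⟨ ∑-distrib-+ (λ u → ∑[ v ∈ V ] (∈a u * ∈b v)) (λ u → ∑[ v ∈ V ] (∈b u * ∈a v)) V ⟩
    ∑[ u ∈ V ] ∑[ v ∈ V ] (∈a u * ∈b v) + ∑[ u ∈ V ] ∑[ v ∈ V ] (∈b u * ∈a v)
      ≡⟨ cong₂ _+_ (∑-product ∈a ∈b V V) (∑-product ∈b ∈a V V) ⟩
    ∑ ∈a V * ∑ ∈b V + ∑ ∈b V * ∑ ∈a V
      ≤⟨ +-mono-≤ (*-mono-≤ (endpoints≤2 a) (endpoints≤2 b)) (*-mono-≤ (endpoints≤2 b) (endpoints≤2 a)) ⟩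
    8 ∎
    where
    open ≤-Reasoning
    ∈a ∈b : Fin n → ℕ
    ∈a u = 𝟙 (does (u ∈ᵉ? a))
    ∈b u = 𝟙 (does (u ∈ᵉ? b))
    joins≤ : ∀ u v → 𝟙 (joins u v (a , b)) ≤ ∈a u * ∈b v + ∈b u * ∈a v
    joins≤ u v = subst (𝟙 (joins u v (a , b)) ≤_)
      (cong₂ _+_ (𝟙-∧ (does (u ∈ᵉ? a)) (does (v ∈ᵉ? b))) (𝟙-∧ (does (u ∈ᵉ? b)) (does (v ∈ᵉ? a))))
      (𝟙-∨ (does (u ∈ᵉ? a) ∧ does (v ∈ᵉ? b)) (does (u ∈ᵉ? b) ∧ does (v ∈ᵉ? a)))

  ∑-length-B : ∑[ u ∈ V ] ∑[ v ∈ V ] length (B p t u v) ≤ 16 * length E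
  ∑-length-B = begin
    ∑[ u ∈ V ] ∑[ v ∈ V ] length (B p t u v)
      ≡⟨ ∑-cong (λ u → ∑-cong (length-B u) V) V ⟩
    ∑[ u ∈ V ] ∑[ v ∈ V ] ∑[ ab ∈ E² ] (𝟙 (near ab) * 𝟙 (joins u v ab))
      ≡⟨ ∑-cong (λ u → ∑-comm (λ v ab → 𝟙 (near ab) * 𝟙 (joins u v ab)) V E²) V ⟩
    ∑[ u ∈ V ] ∑[ ab ∈ E² ] ∑[ v ∈ V ] (𝟙 (near ab) * 𝟙 (joins u v ab))
      ≡⟨ ∑-comm (λ u ab → ∑[ v ∈ V ] (𝟙 (near ab) * 𝟙 (joins u v ab))) V E² ⟩
    ∑[ ab ∈ E² ] ∑[ u ∈ V ] ∑[ v ∈ V ] (𝟙 (near ab) * 𝟙 (joins u v ab))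
      ≡⟨ ∑-cong (λ ab → trans (∑-cong (λ u → ∑-*ˡ (𝟙 (near ab)) (λ v → 𝟙 (joins u v ab)) V) V)
                              (∑-*ˡ (𝟙 (near ab)) (λ u → ∑[ v ∈ V ] 𝟙 (joins u v ab)) V)) E² ⟩
    ∑[ ab ∈ E² ] (𝟙 (near ab) * ∑[ u ∈ V ] ∑[ v ∈ V ] 𝟙 (joins u v ab))
      ≤⟨ ∑-mono-≤ (λ ab → *-monoʳ-≤ (𝟙 (near ab)) (joins-count ab)) E² ⟩
    ∑[ ab ∈ E² ] (𝟙 (near ab) * 8)
      ≡⟨ ∑-*ʳ 8 (𝟙 ∘ near) E² ⟩
    ∑[ ab ∈ E² ] 𝟙 (near ab) * 8
      ≤⟨ *-monoˡ-≤ 8 near-count ⟩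
    length E * 2 * 8
      ≡⟨ trans (*-assoc (length E) 2 8) (*-comm (length E) 16) ⟩
    16 * length E ∎
    where open ≤-Reasoning

  score : Fin n × Fin n → ℕ
  score (u , v) = length (U₊ p t u) + length (U₋ p t v) + 2 * length (B p t u v)

  ∑-score : ∑ score (distinctPairs n) ≤ (n ∸ 1) * degreeSum p t + 16 * length (distinctPairs n)
  ∑-score = begin
    ∑ score P
      ≡⟨ trans (∑-distrib-+ (λ uv → #U₊ (proj₁ uv) + #U₋ (proj₂ uv)) (λ uv → 2 * #B uv) P)
               (cong₂ _+_ (∑-distrib-+ (#U₊ ∘ proj₁) (#U₋ ∘ proj₂) P) (∑-*ˡ 2 #B P)) ⟩
    ∑[ uv ∈ P ] #U₊ (proj₁ uv) + ∑[ uv ∈ P ] #U₋ (proj₂ uv) + 2 * ∑ #B P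
      ≡⟨ cong (_+ 2 * ∑ #B P) (cong₂ _+_ (∑-distinctPairs-proj₁ #U₊) (∑-distinctPairs-proj₂ #U₋)) ⟩
    (n ∸ 1) * ∑ #U₊ V + (n ∸ 1) * ∑ #U₋ V + 2 * ∑ #B P
      ≡⟨ cong (_+ 2 * ∑ #B P) (trans (cong ((n ∸ 1) *_) (∑-distrib-+ #U₊ #U₋ V))
                                     (*-distribˡ-+ (n ∸ 1) (∑ #U₊ V) (∑ #U₋ V))) ⟨
    (n ∸ 1) * degreeSum p t + 2 * ∑ #B P
      ≤⟨ +-monoʳ-≤ ((n ∸ 1) * degreeSum p t) 2*∑#B≤ ⟩
    (n ∸ 1) * degreeSum p t + 16 * length P ∎
    where
    open ≤-Reasoning
    P = distinctPairs n
    #U₊ #U₋ : Fin n → ℕ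
    #U₊ u = length (U₊ p t u)
    #U₋ v = length (U₋ p t v)
    #B : Fin n × Fin n → ℕ
    #B (u , v) = length (B p t u v)
    2*∑#B≤ : 2 * ∑ #B P ≤ 16 * length P
    2*∑#B≤ = begin
      2 * ∑ #B P                                        ≤⟨ *-monoʳ-≤ 2 (∑-filter-≤ _ #B (vertexPairs n)) ⟩
      2 * ∑ #B (vertexPairs n)                          ≡⟨ cong (2 *_) (∑-cartesianProduct #B V V) ⟩
      2 * ∑[ u ∈ V ] ∑[ v ∈ V ] length (B p t u v)      ≤⟨ *-monoʳ-≤ 2 ∑-length-B ⟩
      2 * (16 * length E)                               ≡⟨ trans (sym (*-assoc 2 16 (length E))) (*-assoc 16 2 (length E)) ⟩
      16 * (2 * length E)                               ≤⟨ *-monoʳ-≤ 16 (2*length-edges≤length-distinctPairs n) ⟩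
      16 * length P                                     ∎

ℕ→ℚ≡mkℚ : ∀ a → ℕ→ℚ a ≡ ℚ.mkℚ (ℤ.+ a) 0 (Coprime.sym (Coprime.1-coprimeTo a))
ℕ→ℚ≡mkℚ a = ℚ.normalize-coprime (Coprime.sym (Coprime.1-coprimeTo a))

ℕ→ℚ-+ : ∀ a b → ℕ→ℚ (a + b) ≡ ℕ→ℚ a +ℚ ℕ→ℚ b
ℕ→ℚ-+ a b = sym (trans (cong₂ _+ℚ_ (ℕ→ℚ≡mkℚ a) (ℕ→ℚ≡mkℚ b)) (cong (ℚ._/ 1) numerator))
  where
  numerator : ℤ.+ a ℤ.* ℤ.+ 1 ℤ.+ ℤ.+ b ℤ.* ℤ.+ 1 ≡ ℤ.+ (a + b)
  numerator = trans (cong₂ ℤ._+_ (ℤ.*-identityʳ (ℤ.+ a)) (ℤ.*-identityʳ (ℤ.+ b))) (sym (ℤ.pos-+ a b))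

ℕ→ℚ-* : ∀ a b → ℕ→ℚ (a * b) ≡ ℕ→ℚ a *ℚ ℕ→ℚ b
ℕ→ℚ-* a b = sym (trans (cong₂ _*ℚ_ (ℕ→ℚ≡mkℚ a) (ℕ→ℚ≡mkℚ b)) (cong (ℚ._/ 1) (sym (ℤ.pos-* a b))))

ℕ→ℚ-mono-≤ : ∀ {a b} → a ≤ b → ℕ→ℚ a ≤ℚ ℕ→ℚ b
ℕ→ℚ-mono-≤ {a} {b} a≤b = subst₂ _≤ℚ_ (sym (ℕ→ℚ≡mkℚ a)) (sym (ℕ→ℚ≡mkℚ b))
  (ℚ.*≤* (subst₂ ℤ._≤_ (sym (ℤ.*-identityʳ (ℤ.+ a))) (sym (ℤ.*-identityʳ (ℤ.+ b))) (ℤ.+≤+ a≤b)))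

ℕ→ℚ-suc-* : ∀ k M → ℕ→ℚ (suc k) *ℚ M ≡ M +ℚ ℕ→ℚ k *ℚ M
ℕ→ℚ-suc-* k M = begin
  ℕ→ℚ (1 + k) *ℚ M                ≡⟨ cong (_*ℚ M) (ℕ→ℚ-+ 1 k) ⟩
  (ℚ.1ℚ +ℚ ℕ→ℚ k) *ℚ M            ≡⟨ ℚ.*-distribʳ-+ M ℚ.1ℚ (ℕ→ℚ k) ⟩
  ℚ.1ℚ *ℚ M +ℚ ℕ→ℚ k *ℚ M         ≡⟨ cong (_+ℚ ℕ→ℚ k *ℚ M) (ℚ.*-identityˡ M) ⟩
  M +ℚ ℕ→ℚ k *ℚ M                 ∎
  where open ≡-Reasoning

module _ (f : X → ℕ) (M : ℚ) where

  private
    Above : X → Set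
    Above x = M ℚ.< ℕ→ℚ (f x)

  length*≤∑ : ∀ {xs} → All Above xs → ℕ→ℚ (length xs) *ℚ M ≤ℚ ℕ→ℚ (∑ f xs)
  length*<∑ : ∀ {x xs} → All Above (x ∷ xs) → ℕ→ℚ (length (x ∷ xs)) *ℚ M ℚ.< ℕ→ℚ (∑ f (x ∷ xs))

  length*≤∑ []                = ℚ.≤-reflexive (ℚ.*-zeroˡ M)
  length*≤∑ above@(_ ∷ _)     = ℚ.<⇒≤ (length*<∑ above)

  length*<∑ {x} {xs} (M<fx ∷ above) = subst₂ ℚ._<_ (sym (ℕ→ℚ-suc-* (length xs) M)) (sym (ℕ→ℚ-+ (f x) (∑ f xs)))
    (ℚ.+-mono-<-≤ M<fx (length*≤∑ above))

  below-average : ∀ xs → 0 < length xs → ℕ→ℚ (∑ f xs) ≤ℚ ℕ→ℚ (length xs) *ℚ M →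
                  Any (λ x → ℕ→ℚ (f x) ≤ℚ M) xs
  below-average xs@(_ ∷ _) _ ∑≤ with any? (λ x → ℕ→ℚ (f x) ℚ.≤? M) xs
  ... | yes found = found
  ... | no none   = contradiction (ℚ.≤-<-trans ∑≤ (length*<∑ (All.map ℚ.≰⇒> (¬Any⇒All¬ xs none)))) (ℚ.<-irrefl refl)

rescale : ∀ {S D k n N : ℕ} {m : ℚ} → N ≡ k * n → S ≤ k * D + 16 * N → ℕ→ℚ D ≤ℚ ℕ→ℚ n *ℚ m →
          ℕ→ℚ S ≤ℚ ℕ→ℚ N *ℚ (m +ℚ ℕ→ℚ 16)
rescale {S} {D} {k} {n} {m = m} refl S≤ D≤nm = begin
  ℕ→ℚ S
    ≤⟨ ℕ→ℚ-mono-≤ S≤ ⟩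
  ℕ→ℚ (k * D + 16 * (k * n))
    ≡⟨ trans (ℕ→ℚ-+ (k * D) (16 * (k * n))) (cong₂ _+ℚ_ (ℕ→ℚ-* k D) (trans (ℕ→ℚ-* 16 (k * n)) (cong (ℕ→ℚ 16 *ℚ_) (ℕ→ℚ-* k n)))) ⟩
  ℕ→ℚ k *ℚ ℕ→ℚ D +ℚ ℕ→ℚ 16 *ℚ (ℕ→ℚ k *ℚ ℕ→ℚ n)
    ≤⟨ ℚ.+-monoˡ-≤ (ℕ→ℚ 16 *ℚ (ℕ→ℚ k *ℚ ℕ→ℚ n)) (ℚ.*-monoˡ-≤-nonNeg (ℕ→ℚ k) {{ℚ.normalize-nonNeg k 1}} D≤nm) ⟩
  ℕ→ℚ k *ℚ (ℕ→ℚ n *ℚ m) +ℚ ℕ→ℚ 16 *ℚ (ℕ→ℚ k *ℚ ℕ→ℚ n)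
    ≡⟨ solve 4 (λ K N m c → K :* (N :* m) :+ c :* (K :* N) := (K :* N) :* (m :+ c)) refl (ℕ→ℚ k) (ℕ→ℚ n) m (ℕ→ℚ 16) ⟩
  (ℕ→ℚ k *ℚ ℕ→ℚ n) *ℚ (m +ℚ ℕ→ℚ 16)
    ≡⟨ cong (_*ℚ (m +ℚ ℕ→ℚ 16)) (ℕ→ℚ-* k n) ⟨
  ℕ→ℚ (k * n) *ℚ (m +ℚ ℕ→ℚ 16) ∎
  where
  open ℚ.≤-Reasoning
  open +-*-Solver

lemma4p2 : (n : ℕ) → 2 ≤ n → (t : Labeling n) → (p : ℕ) → p > 0 → (m : ℚ)
    → ℕ→ℚ (degreeSum p t) ≤ℚ ℕ→ℚ n *ℚ m
    → Σ[ u ∈ Fin n ] Σ[ v ∈ Fin n ] (¬ u ≡ v)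
        × (ℕ→ℚ (length (U₊ p t u) + length (U₋ p t v) + 2 * length (B p t u v)) ≤ℚ m +ℚ ℕ→ℚ 16)
lemma4p2 n 2≤n t p _ m degreeSum≤nm =
  let (u , v) , uv∈pairs , score≤ = find (below-average (score t p) (m +ℚ ℕ→ℚ 16) pairs nonempty average)
  in  u , v , ∈-distinctPairs⇒≢ uv∈pairs , score≤
  where
  pairs = distinctPairs n
  nonempty : 0 < length pairs
  nonempty = subst (0 <_) (sym (length-distinctPairs {n}))
    (*-mono-≤ {1} {n ∸ 1} {1} {n} (∸-monoˡ-≤ 1 2≤n) (≤-trans (s≤s z≤n) 2≤n))
  average : ℕ→ℚ (∑ (score t p) pairs) ≤ℚ ℕ→ℚ (length pairs) *ℚ (m +ℚ ℕ→ℚ 16)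
  average = rescale {k = n ∸ 1} {n = n} {m = m} (length-distinctPairs {n}) (∑-score t p) degreeSum≤nm
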